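{- A reduced graph contains no induced subgraph isomorphic to $C_{2\ell+1}^*$ for any $\ell\ge 1$.
   Context: $C_\ell$ is the cycle on $\ell$ vertices, $C_\ell^*$ is $C_\ell$ plus an isolated vertex, and $\overline{H}$ is the complement of $H$. $S_3$ (tent): triangle $a_1a_2a_3$ plus $b_1,b_2,b_3$ with $b_i$ adjacent exactly to $a_i,a_{i+1}$ (indices mod 3); $S_3^*$ is $S_3$ plus an isolated vertex. $F_1$ (long claw): a vertex with three pendant paths each of length $2$. $F_2$: a 4-cycle $x_1x_2x_3x_4$ with three further vertices, pendant at $x_1$, $x_2$, $x_3$ respectively. $F_3$: a 6-cycle $y_1\cdots y_6$ with chord $y_1y_4$, plus a pendant vertex adjacent only to $y_1$. $F_4$: the same 6-cycle with chord $y_1y_4$, plus a vertex adjacent exactly to $y_1$ and $y_4$. A graph is reduced if it is connected, its complement is connected, and it contains no induced subgraph isomorphic to $C_3^*$, $C_5^*$, $\overline{C_4^*}$, $C_6$, $S_3$, $\overline{S_3^*}$, $F_1$, $F_2$, $F_3$, or $F_4$. -}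

module Defs where

open import Data.Nat using (ℕ; zero; suc; _∸_; _≡ᵇ_; _<ᵇ_)
open import Data.Fin using (Fin; toℕ; _≟_)
open import Data.Bool using (Bool; true; false; _∧_; _∨_; not)
open import Data.Bool.Properties using (∨-comm)
open import Data.List using (List; []; _∷_)
open import Data.Bool.ListAction using (any)
open import Data.Product using (_×_; _,_; Σ)
open import Data.Empty using (⊥-elim)
open import Relation.Nullary using (¬_; yes; no)
open import Relation.Nullary.Decidable using (⌊_⌋)
open import Relation.Binary.PropositionalEquality using (_≡_; refl; sym)
open import Function.Definitions using (Injective)

record Graph : Set where
  field
    n      : ℕ
    adj    : Fin n → Fin n → Bool
    adj-sym   : ∀ i j → adj i j ≡ adj j i
    adj-irrefl : ∀ i → adj i i ≡ false
open Graph public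

symAdj : ∀ {k} → (Fin k → Fin k → Bool) → Fin k → Fin k → Bool
symAdj e i j = not ⌊ i ≟ j ⌋ ∧ (e i j ∨ e j i)

symAdj-sym : ∀ {k} (e : Fin k → Fin k → Bool) i j → symAdj e i j ≡ symAdj e j i
symAdj-sym e i j with i ≟ j | j ≟ i
... | yes refl | yes _ = refl
... | yes refl | no ¬p = ⊥-elim (¬p refl)
... | no ¬p | yes q = ⊥-elim (¬p (sym q))
... | no _ | no _ = ∨-comm (e i j) (e j i)

symAdj-irrefl : ∀ {k} (e : Fin k → Fin k → Bool) i → symAdj e i i ≡ false
symAdj-irrefl e i with i ≟ i
... | yes _ = refl
... | no ¬p with ¬p refl
... | ()

mkGraph : (k : ℕ) → (Fin k → Fin k → Bool) → Graph
mkGraph k e = record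
  { n = k ; adj = symAdj e ; adj-sym = symAdj-sym e ; adj-irrefl = symAdj-irrefl e }

fromEdges : (k : ℕ) → List (ℕ × ℕ) → Graph
fromEdges k es = mkGraph k (λ i j → any (λ { (a , b) → (toℕ i ≡ᵇ a) ∧ (toℕ j ≡ᵇ b) }) es)

complement : Graph → Graph
complement G = mkGraph (n G) (λ i j → not (adj G i j))

-- Cycle C_m on vertices 0,…,m-1 (i ~ i+1, and m-1 ~ 0); meaningful for m ≥ 3.
cycleEdge : (m : ℕ) → ∀ {k} → Fin k → Fin k → Bool
cycleEdge m i j = ((toℕ j ≡ᵇ suc (toℕ i)) ∧ (toℕ j <ᵇ m))
                  ∨ ((toℕ i ≡ᵇ m ∸ 1) ∧ (toℕ j ≡ᵇ 0))

C : ℕ → Graph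
C m = mkGraph m (cycleEdge m)

-- C_m^* : C_m plus an isolated vertex (the vertex numbered m).
Cstar : ℕ → Graph
Cstar m = mkGraph (suc m) (cycleEdge m)

data Reach (G : Graph) (u : Fin (n G)) : Fin (n G) → Set where
  here : Reach G u u
  step : ∀ {v w} → Reach G u v → adj G v w ≡ true → Reach G u w

Connected : Graph → Set
Connected G = ∀ u v → Reach G u v

InducedSub : Graph → Graph → Set
InducedSub H G = Σ (Fin (n H) → Fin (n G)) λ f →
  Injective _≡_ _≡_ f × (∀ i j → adj G (f i) (f j) ≡ adj H i j)

-- Tent S_3: a1,a2,a3 = 0,1,2 ; b1,b2,b3 = 3,4,5.
S3edges : List (ℕ × ℕ)
S3edges = (0 , 1) ∷ (1 , 2) ∷ (2 , 0) ∷ (3 , 0) ∷ (3 , 1) ∷ (4 , 1) ∷ (4 , 2) ∷ (5 , 2) ∷ (5 , 0) ∷ []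

S3 S3star : Graph
S3 = fromEdges 6 S3edges
S3star = fromEdges 7 S3edges   -- vertex 6 isolated

-- F1 (long claw): centre 0, paths 0-1-2, 0-3-4, 0-5-6.
F1 : Graph
F1 = fromEdges 7 ((0 , 1) ∷ (1 , 2) ∷ (0 , 3) ∷ (3 , 4) ∷ (0 , 5) ∷ (5 , 6) ∷ [])

-- F2: 4-cycle x1..x4 = 0..3, pendants 4,5,6 at x1,x2,x3.
F2 : Graph
F2 = fromEdges 7 ((0 , 1) ∷ (1 , 2) ∷ (2 , 3) ∷ (3 , 0) ∷ (4 , 0) ∷ (5 , 1) ∷ (6 , 2) ∷ [])

-- 6-cycle y1..y6 = 0..5 with chord y1y4 = (0,3).
hexChord : List (ℕ × ℕ)
hexChord = (0 , 1) ∷ (1 , 2) ∷ (2 , 3) ∷ (3 , 4) ∷ (4 , 5) ∷ (5 , 0) ∷ (0 , 3) ∷ []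

F3 F4 : Graph
F3 = fromEdges 7 ((6 , 0) ∷ hexChord)
F4 = fromEdges 7 ((6 , 0) ∷ (6 , 3) ∷ hexChord)

Reduced : Graph → Set
Reduced G =
  Connected G × Connected (complement G)
  × ¬ InducedSub (Cstar 3) G
  × ¬ InducedSub (Cstar 5) G
  × ¬ InducedSub (complement (Cstar 4)) G
  × ¬ InducedSub (C 6) G
  × ¬ InducedSub S3 G
  × ¬ InducedSub (complement S3star) G
  × ¬ InducedSub F1 G
  × ¬ InducedSub F2 G
  × ¬ InducedSub F3 G
  × ¬ InducedSub F4 G

-- Let C be an induced C_m^* (m ≥ 6, isolated vertex v) in a connected graph without induced
-- C_3^*, bowtie (the complement of C_4^*), F1 or F2.  On a path from v to the cycle, the first
-- vertex x with a neighbour on the cycle has a predecessor y with none.  If x sees the whole cycle,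
-- x and two disjoint cycle edges form a bowtie.  Otherwise there are consecutive cycle vertices
-- w₃ ~ x ≁ w₄, and whatever the adjacencies of x to w₀, w₁, w₂, w₅, w₆ are, some of these seven
-- vertices together with x and y induce C_3^*, a bowtie, F1 or F2.  For m = 3 and 5 a reduced graph
-- excludes C_m^* by definition.

module Submission where

open import Defs
open import Data.Nat using (ℕ; zero; suc; _+_; _*_; _∸_; _≤_; _<_; _≡ᵇ_; _<ᵇ_; ∣_-_∣; z≤n; s≤s; z<s; NonZero; >-nonZero; >-nonZero⁻¹)
open import Data.Nat.Properties using (≤-refl; ≤-trans; ≤-total; <⇒≤; <-trans; <-irrefl; <⇒≱; n<1+n; m≤n⇒m≤1+n; m≤n⇒m<n∨m≡n; +-comm; +-assoc; +-suc; +-identityʳ; +-cancelˡ-≡; +-monoˡ-≤; m≤n+m; *-monoʳ-≤; m+[n∸m]≡n; m∸n+n≡m; m≤n⇒∣m-n∣≡n∸m; ∣-∣-comm; ≡ᵇ⇒≡; ≡⇒≡ᵇ; <ᵇ⇒<; <⇒<ᵇ)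
open import Data.Nat.DivMod using (_%_; _/_; _mod_; m≡m%n+[m/n]*n; m%n<n; m%n%n≡m%n; m<n⇒m%n≡m; n%n≡0; [m+n]%n≡m%n; %-distribˡ-+)
open import Data.Nat.Divisibility using (_∣_; divides; ∣⇒≤; ∣m+n∣m⇒∣n; n∣m*n)
open import Data.Fin using (Fin; toℕ; fromℕ; inject₁; #_; _≟_)
import Data.Fin.Properties as Fin
open import Data.Fin.Properties using (toℕ-injective; toℕ-inject₁; toℕ-fromℕ<; toℕ-fromℕ)
open import Data.Bool using (Bool; true; false; T; _∧_)
import Data.Bool.Properties as Bool
open import Data.Bool.Properties using (T-∧; T-∨; T-≡; ¬-not)
open import Data.Maybe using (Maybe; just; nothing)
open import Data.Maybe.Properties using (≡-dec)
open import Data.Maybe.Relation.Unary.All as Maybe using (just; nothing)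
open import Data.Vec using (Vec; []; _∷_; lookup; tabulate)
open import Data.Vec.Properties using (lookup∘tabulate)
open import Data.Vec.Relation.Binary.Pointwise.Inductive as Pointwise using (Pointwise; []; _∷_)
open import Data.Product using (∃; ∃-syntax; ∃₂; _×_; _,_; proj₁; proj₂; map₁; map₂)
open import Data.Sum using (_⊎_; inj₁; inj₂)
open import Data.Empty using (⊥)
open import Function using (_∘_)
open import Function.Bundles using (module Equivalence)
open import Relation.Nullary using (¬_; Dec; yes; no; contradiction; ¬?)
open import Relation.Nullary.Decidable using (True; toWitness; _⊎-dec_)
open import Relation.Unary using (Pred; Decidable)
open import Relation.Binary.PropositionalEquality

open Equivalence using (from; to)

+-%-≢ : ∀ i {k m} .{{_ : NonZero m}} → 0 < k → k < m → (i + k) % m ≢ i % m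
+-%-≢ i {k} {m} 0<k k<m eq = <⇒≱ k<m (∣⇒≤ {{>-nonZero 0<k}} m∣k)
  where
  open ≡-Reasoning
  r q q′ : ℕ
  r = i % m
  q = i / m
  q′ = (i + k) / m
  shifted : r + (q * m + k) ≡ r + q′ * m
  shifted = begin
    r + (q * m + k)       ≡⟨ +-assoc r (q * m) k ⟨
    r + q * m + k         ≡⟨ cong (_+ k) (m≡m%n+[m/n]*n i m) ⟨
    i + k                 ≡⟨ m≡m%n+[m/n]*n (i + k) m ⟩
    (i + k) % m + q′ * m  ≡⟨ cong (_+ q′ * m) eq ⟩
    r + q′ * m            ∎
  m∣k : m ∣ k
  m∣k = ∣m+n∣m⇒∣n (divides q′ (+-cancelˡ-≡ r _ _ shifted)) (n∣m*n q)

[k+m%n]%n≡[k+m]%n : ∀ k i m .{{_ : NonZero m}} → (k + i % m) % m ≡ (k + i) % m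
[k+m%n]%n≡[k+m]%n k i m = begin
  (k + i % m) % m          ≡⟨ %-distribˡ-+ k (i % m) m ⟩
  (k % m + i % m % m) % m  ≡⟨ cong (λ r → (k % m + r) % m) (m%n%n≡m%n i m) ⟩
  (k % m + i % m) % m      ≡⟨ %-distribˡ-+ k i m ⟨
  (k + i) % m              ∎
  where open ≡-Reasoning

¬T⇒≡false : ∀ {b} → ¬ T b → b ≡ false
¬T⇒≡false ¬b = ¬-not (¬b ∘ from T-≡)

symAdj-true : ∀ {k} (e : Fin k → Fin k → Bool) {i j} → i ≢ j → T (e i j) → symAdj e i j ≡ true
symAdj-true e {i} {j} i≢j eij with i ≟ j
... | yes i≡j = contradiction i≡j i≢j
... | no _    = to T-≡ (from T-∨ (inj₁ eij))

symAdj-false : ∀ {k} (e : Fin k → Fin k → Bool) {i j} → ¬ T (e i j) → ¬ T (e j i) → symAdj e i j ≡ false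
symAdj-false e {i} {j} ¬eij ¬eji = ¬T⇒≡false (either ∘ to T-∨ ∘ proj₂ ∘ to T-∧)
  where
  either : T (e i j) ⊎ T (e j i) → ⊥
  either (inj₁ eij) = ¬eij eij
  either (inj₂ eji) = ¬eji eji

module _ {m : ℕ} .{{_ : NonZero m}} {k : ℕ} {p q : Fin k} where

  private
    a b : ℕ
    a = toℕ p
    b = toℕ q

  cycleEdge-sound : T (cycleEdge m p q) → a < m × b ≡ suc a % m
  cycleEdge-sound e with to (T-∨ {(b ≡ᵇ suc a) ∧ (b <ᵇ m)}) e
  ... | inj₁ e₁ = <-trans (n<1+n a) 1+a<m , trans b≡1+a (sym (m<n⇒m%n≡m 1+a<m))
    where
    b≡1+a : b ≡ suc a
    b≡1+a = ≡ᵇ⇒≡ b (suc a) (proj₁ (to (T-∧ {b ≡ᵇ suc a}) e₁))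
    1+a<m : suc a < m
    1+a<m = subst (_< m) b≡1+a (<ᵇ⇒< b m (proj₂ (to (T-∧ {b ≡ᵇ suc a}) e₁)))
  ... | inj₂ e₂ = subst (a <_) 1+a≡m (n<1+n a) , trans b≡0 (sym (trans (cong (_% m) 1+a≡m) (n%n≡0 m)))
    where
    1+a≡m : suc a ≡ m
    1+a≡m = trans (cong suc (≡ᵇ⇒≡ a (m ∸ 1) (proj₁ (to (T-∧ {a ≡ᵇ m ∸ 1}) e₂)))) (m+[n∸m]≡n (>-nonZero⁻¹ m))
    b≡0 : b ≡ 0
    b≡0 = ≡ᵇ⇒≡ b 0 (proj₂ (to (T-∧ {a ≡ᵇ m ∸ 1}) e₂))

  cycleEdge-complete : a < m → b ≡ suc a % m → T (cycleEdge m p q)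
  cycleEdge-complete a<m b≡[1+a]%m with m≤n⇒m<n∨m≡n a<m
  ... | inj₁ 1+a<m = from (T-∨ {(b ≡ᵇ suc a) ∧ (b <ᵇ m)})
                       (inj₁ (from T-∧ (≡⇒≡ᵇ b (suc a) b≡1+a , <⇒<ᵇ (subst (_< m) (sym b≡1+a) 1+a<m))))
    where
    b≡1+a : b ≡ suc a
    b≡1+a = trans b≡[1+a]%m (m<n⇒m%n≡m 1+a<m)
  ... | inj₂ 1+a≡m = from (T-∨ {(b ≡ᵇ suc a) ∧ (b <ᵇ m)})
                       (inj₂ (from T-∧ (≡⇒≡ᵇ a (m ∸ 1) (cong (_∸ 1) 1+a≡m) , ≡⇒≡ᵇ b 0 b≡0)))
    where
    b≡0 : b ≡ 0
    b≡0 = trans b≡[1+a]%m (trans (cong (_% m) 1+a≡m) (n%n≡0 m))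

module _ {m : ℕ} .{{_ : NonZero m}} where

  cyc : ℕ → Fin (suc m)
  cyc i = inject₁ (i mod m)

  toℕ-cyc : ∀ i → toℕ (cyc i) ≡ i % m
  toℕ-cyc i = trans (toℕ-inject₁ (i mod m)) (toℕ-fromℕ< (m%n<n i m))

  cyc-cong : ∀ {i j} → i % m ≡ j % m → cyc i ≡ cyc j
  cyc-cong {i} {j} eq = toℕ-injective (trans (toℕ-cyc i) (trans eq (sym (toℕ-cyc j))))

  cyc-edge⇒ : ∀ {i j} → T (cycleEdge m (cyc i) (cyc j)) → j % m ≡ suc i % m
  cyc-edge⇒ {i} {j} e = begin
    j % m                  ≡⟨ toℕ-cyc j ⟨
    toℕ (cyc j)            ≡⟨ proj₂ (cycleEdge-sound e) ⟩
    suc (toℕ (cyc i)) % m  ≡⟨ cong (λ r → suc r % m) (toℕ-cyc i) ⟩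
    suc (i % m) % m        ≡⟨ [k+m%n]%n≡[k+m]%n 1 i m ⟩
    suc i % m              ∎
    where open ≡-Reasoning

  cyc-adj-suc : 2 ≤ m → ∀ i → adj (Cstar m) (cyc i) (cyc (suc i)) ≡ true
  cyc-adj-suc 2≤m i = symAdj-true (cycleEdge m) distinct
    (cycleEdge-complete (subst (_< m) (sym (toℕ-cyc i)) (m%n<n i m)) (begin
      toℕ (cyc (suc i))      ≡⟨ toℕ-cyc (suc i) ⟩
      suc i % m              ≡⟨ [k+m%n]%n≡[k+m]%n 1 i m ⟨
      suc (i % m) % m        ≡⟨ cong (λ r → suc r % m) (toℕ-cyc i) ⟨
      suc (toℕ (cyc i)) % m  ∎))
    where
    open ≡-Reasoning
    distinct : cyc i ≢ cyc (suc i)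
    distinct eq = +-%-≢ i z<s 2≤m (begin
      (i + 1) % m        ≡⟨ cong (_% m) (+-comm i 1) ⟩
      suc i % m          ≡⟨ toℕ-cyc (suc i) ⟨
      toℕ (cyc (suc i))  ≡⟨ cong toℕ eq ⟨
      toℕ (cyc i)        ≡⟨ toℕ-cyc i ⟩
      i % m              ∎)

  cyc-nonadj : ∀ i {d} → 2 ≤ d → suc d < m → adj (Cstar m) (cyc i) (cyc (i + d)) ≡ false
  cyc-nonadj i {suc d} (s≤s 1≤d) 2+d<m = symAdj-false (cycleEdge m) {cyc i} {cyc (i + suc d)}
    (λ e → +-%-≢ (suc i) 1≤d (<-trans (n<1+n d) (<-trans (n<1+n (suc d)) 2+d<m))
             (trans (cong (_% m) (sym (+-suc i d))) (cyc-edge⇒ {i} e)))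
    (λ e → +-%-≢ i z<s 2+d<m (trans (cong (_% m) (+-suc i (suc d))) (sym (cyc-edge⇒ {i + suc d} e))))

  cyc-isolated : ∀ q → adj (Cstar m) (fromℕ m) q ≡ false
  cyc-isolated q = symAdj-false (cycleEdge m) {fromℕ m} {q}
    (λ e → m≮m (proj₁ (cycleEdge-sound e)))
    (λ e → m≮m (subst (_< m) (sym (proj₂ (cycleEdge-sound e))) (m%n<n (suc (toℕ q)) m)))
    where
    m≮m : ¬ toℕ (fromℕ m) < m
    m≮m = <-irrefl (toℕ-fromℕ m)

Separated : (H : Graph) → Fin (n H) → Fin (n H) → Set
Separated H i j = i ≡ j ⊎ adj H i j ≡ true ⊎ ∃[ k ] adj H i k ≢ adj H j k

TwinFree : Graph → Set
TwinFree H = ∀ i j → Separated H i j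

twinFree? : (H : Graph) → Dec (TwinFree H)
twinFree? H = Fin.all? λ i → Fin.all? λ j →
  (i Fin.≟ j) ⊎-dec (adj H i j Bool.≟ true) ⊎-dec Fin.any? (λ k → ¬? (adj H i k Bool.≟ adj H j k))

-- h i ≡ h j makes i and j non-adjacent twins, which twin-freeness excludes.
adjacency-preserving⇒induced : ∀ {H G} → TwinFree H → (h : Fin (n H) → Fin (n G)) →
  (∀ i j → adj G (h i) (h j) ≡ adj H i j) → InducedSub H G
adjacency-preserving⇒induced {H} {G} twinFree h h-adj = h , injective , h-adj
  where
  injective : ∀ {i j} → h i ≡ h j → i ≡ j
  injective {i} {j} hi≡hj with twinFree i j
  ... | inj₁ i≡j = i≡j
  ... | inj₂ (inj₁ i~j) = contradiction (trans (sym loop) (trans (h-adj i j) i~j)) λ ()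
    where
    loop : adj G (h i) (h j) ≡ false
    loop = trans (cong (λ v → adj G v (h j)) hi≡hj) (adj-irrefl G (h j))
  ... | inj₂ (inj₂ (k , differ)) =
    contradiction (trans (sym (h-adj i k)) (trans (cong (λ v → adj G v (h k)) hi≡hj) (h-adj j k))) differ

crossing-edge : ∀ {G ℓ} (P : Pred (Fin (n G)) ℓ) → Decidable P → ∀ {u v} → Reach G u v → ¬ P u → P v →
  ∃₂ λ x y → adj G x y ≡ true × P x × ¬ P y
crossing-edge P P? here ¬Pu Pu = contradiction Pu ¬Pu
crossing-edge {G} P P? (step {v} {w} u⇝v v~w) ¬Pu Pw with P? v
... | yes Pv = crossing-edge P P? u⇝v ¬Pu Pv
... | no ¬Pv = w , v , trans (adj-sym G w v) v~w , Pw , ¬Pv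

falling-edge : (s : ℕ → Bool) → ∀ {j e} → j ≤ e → s j ≡ true → s e ≡ false →
  ∃[ a ] j ≤ a × s a ≡ true × s (suc a) ≡ false
falling-edge s {e = zero} z≤n sj se = contradiction (trans (sym sj) se) λ ()
falling-edge s {e = suc e} j≤1+e sj s1+e with m≤n⇒m<n∨m≡n j≤1+e
... | inj₂ refl = contradiction (trans (sym sj) s1+e) λ ()
... | inj₁ (s≤s j≤e) with s e in se
...   | true  = e , j≤e , se , s1+e
...   | false = falling-edge s j≤e sj se

-- A window w₀ … w₆ of consecutive cycle vertices, a vertex x, and a neighbour y of x
-- that has no neighbour on the cycle.
data Spot : Set where
  W   : Fin 7 → Spot
  X Y : Spot

-- On an induced cycle of length at least 6, vertices at distance d ≤ 4 along the cycle
-- are adjacent exactly when d = 1.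
distanceAdj : ℕ → Maybe Bool
distanceAdj 0 = just false
distanceAdj 1 = just true
distanceAdj 2 = just false
distanceAdj 3 = just false
distanceAdj 4 = just false
distanceAdj _ = nothing

expected : Vec (Maybe Bool) 7 → Spot → Spot → Maybe Bool
expected p (W s) (W t) = distanceAdj ∣ toℕ s - toℕ t ∣
expected p (W s) X     = lookup p s
expected p X     (W t) = lookup p t
expected p (W _) Y     = just false
expected p Y     (W _) = just false
expected p X     Y     = just true
expected p Y     X     = just true
expected p X     X     = just false
expected p Y     Y     = just false

Realises : Vec (Maybe Bool) 7 → (H : Graph) → Vec Spot (n H) → Set
Realises p H σ = ∀ i j → expected p (lookup σ i) (lookup σ j) ≡ just (adj H i j)

realises? : ∀ p H σ → Dec (Realises p H σ)
realises? p H σ = Fin.all? λ i → Fin.all? λ j →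
  ≡-dec Bool._≟_ (expected p (lookup σ i) (lookup σ j)) (just (adj H i j))

Agrees : Bool → Maybe Bool → Set
Agrees b = Maybe.All (b ≡_)

agrees-just : ∀ {b m β} → Agrees b m → m ≡ just β → b ≡ β
agrees-just (just b≡β) refl = b≡β

LocallyChordless : (G : Graph) → (ℕ → Fin (n G)) → Set
LocallyChordless G w = ∀ i d {β} → distanceAdj d ≡ just β → adj G (w i) (w (i + d)) ≡ β

module LocalPicture (G : Graph) (w : ℕ → Fin (n G)) (w-near : LocallyChordless G w)
  (x y : Fin (n G)) (x~y : adj G x y ≡ true) (y≁w : ∀ i → adj G y (w i) ≡ false) where

  w-adj-≤ : ∀ {s t β} → s ≤ t → distanceAdj ∣ s - t ∣ ≡ just β → adj G (w s) (w t) ≡ β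
  w-adj-≤ {s} {t} {β} s≤t e = subst (λ k → adj G (w s) (w k) ≡ β) (m+[n∸m]≡n s≤t)
    (w-near s (t ∸ s) (trans (cong distanceAdj (sym (m≤n⇒∣m-n∣≡n∸m s≤t))) e))

  w-adj : ∀ s t {β} → distanceAdj ∣ s - t ∣ ≡ just β → adj G (w s) (w t) ≡ β
  w-adj s t e with ≤-total s t
  ... | inj₁ s≤t = w-adj-≤ s≤t e
  ... | inj₂ t≤s = trans (adj-sym G (w s) (w t)) (w-adj-≤ t≤s (trans (cong distanceAdj (∣-∣-comm t s)) e))

  place : Spot → Fin (n G)
  place (W t) = w (toℕ t)
  place X     = x
  place Y     = y

  x-row : Vec Bool 7
  x-row = tabulate λ t → adj G x (w (toℕ t))

  module _ {p : Vec (Maybe Bool) 7} (x-matches : Pointwise Agrees x-row p) where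

    x-w : ∀ t {β} → lookup p t ≡ just β → adj G x (w (toℕ t)) ≡ β
    x-w t e = trans (sym (lookup∘tabulate (λ t → adj G x (w (toℕ t))) t)) (agrees-just (Pointwise.lookup x-matches t) e)

    place-sound : ∀ a b {β} → expected p a b ≡ just β → adj G (place a) (place b) ≡ β
    place-sound (W s) (W t) e = w-adj (toℕ s) (toℕ t) e
    place-sound (W s) X     e = trans (adj-sym G _ x) (x-w s e)
    place-sound X     (W t) e = x-w t e
    place-sound (W s) Y     refl = trans (adj-sym G _ y) (y≁w (toℕ s))
    place-sound Y     (W t) refl = y≁w (toℕ t)
    place-sound X     Y     refl = x~y
    place-sound Y     X     refl = trans (adj-sym G y x) x~y
    place-sound X     X     refl = adj-irrefl G x
    place-sound Y     Y     refl = adj-irrefl G y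

    -- Both implicit arguments are discharged by evaluation at each use.
    embed : ∀ H (σ : Vec Spot (n H)) {_ : True (twinFree? H)} {_ : True (realises? p H σ)} →
            InducedSub H G
    embed H σ {twinFree} {σ-realises} = adjacency-preserving⇒induced {H} {G} (toWitness twinFree) (place ∘ lookup σ)
      λ i j → place-sound (lookup σ i) (lookup σ j) (toWitness σ-realises i j)

Bowtie : Graph
Bowtie = complement (Cstar 4)

module _ {G : Graph}
  (no-C₃* : ¬ InducedSub (Cstar 3) G) (no-bowtie : ¬ InducedSub Bowtie G)
  (no-F₁ : ¬ InducedSub F1 G) (no-F₂ : ¬ InducedSub F2 G) where

  module Hook (w : ℕ → Fin (n G)) (w-near : LocallyChordless G w)
    (x y : Fin (n G)) (x~y : adj G x y ≡ true) (y≁w : ∀ i → adj G y (w i) ≡ false) where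

    open LocalPicture G w w-near x y x~y y≁w

    saturated : adj G x (w 0) ≡ true → adj G x (w 1) ≡ true → adj G x (w 3) ≡ true → adj G x (w 4) ≡ true → ⊥
    saturated e₀ e₁ e₃ e₄ = no-bowtie (embed (just e₀ ∷ just e₁ ∷ nothing ∷ just e₃ ∷ just e₄ ∷ nothing ∷ nothing ∷ [])
      Bowtie (W (# 0) ∷ W (# 3) ∷ W (# 1) ∷ W (# 4) ∷ X ∷ []))

    falling : adj G x (w 3) ≡ true → adj G x (w 4) ≡ false → ⊥
    falling e₃ e₄ with adj G x (w 2) in e₂ | adj G x (w 5) in e₅
    ... | false | false with adj G x (w 1) in e₁
    ...   | false = no-F₁ (embed (nothing ∷ just e₁ ∷ just e₂ ∷ just e₃ ∷ just e₄ ∷ just e₅ ∷ nothing ∷ [])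
                      F1 (W (# 3) ∷ X ∷ Y ∷ W (# 4) ∷ W (# 5) ∷ W (# 2) ∷ W (# 1) ∷ []))
    ...   | true with adj G x (w 0) in e₀
    ...     | false = no-F₂ (embed (just e₀ ∷ just e₁ ∷ just e₂ ∷ just e₃ ∷ just e₄ ∷ nothing ∷ nothing ∷ [])
                        F2 (W (# 1) ∷ X ∷ W (# 3) ∷ W (# 2) ∷ W (# 0) ∷ Y ∷ W (# 4) ∷ []))
    ...     | true  = no-C₃* (embed (just e₀ ∷ just e₁ ∷ nothing ∷ nothing ∷ just e₄ ∷ nothing ∷ nothing ∷ [])
                        (Cstar 3) (X ∷ W (# 1) ∷ W (# 0) ∷ W (# 4) ∷ []))
    falling e₃ e₄ | false | true with adj G x (w 6) in e₆
    ...   | false = no-F₂ (embed (nothing ∷ nothing ∷ just e₂ ∷ just e₃ ∷ just e₄ ∷ just e₅ ∷ just e₆ ∷ [])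
                      F2 (W (# 5) ∷ X ∷ W (# 3) ∷ W (# 4) ∷ W (# 6) ∷ Y ∷ W (# 2) ∷ []))
    ...   | true  = no-C₃* (embed (nothing ∷ nothing ∷ just e₂ ∷ nothing ∷ nothing ∷ just e₅ ∷ just e₆ ∷ [])
                      (Cstar 3) (X ∷ W (# 5) ∷ W (# 6) ∷ W (# 2) ∷ []))
    falling e₃ e₄ | true | false = no-C₃* (embed (nothing ∷ nothing ∷ just e₂ ∷ just e₃ ∷ nothing ∷ just e₅ ∷ nothing ∷ [])
                      (Cstar 3) (X ∷ W (# 2) ∷ W (# 3) ∷ W (# 5) ∷ []))
    falling e₃ e₄ | true | true with adj G x (w 6) in e₆
    ...   | false = no-C₃* (embed (nothing ∷ nothing ∷ just e₂ ∷ just e₃ ∷ nothing ∷ nothing ∷ just e₆ ∷ [])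
                      (Cstar 3) (X ∷ W (# 2) ∷ W (# 3) ∷ W (# 6) ∷ []))
    ...   | true  = no-bowtie (embed (nothing ∷ nothing ∷ just e₂ ∷ just e₃ ∷ nothing ∷ just e₅ ∷ just e₆ ∷ [])
                      Bowtie (W (# 2) ∷ W (# 5) ∷ W (# 3) ∷ W (# 6) ∷ X ∷ []))

  module _ (connected : Connected G) {m : ℕ} .{{_ : NonZero m}} (6≤m : 6 ≤ m)
    (f : Fin (suc m) → Fin (n G)) (f-adj : ∀ i j → adj G (f i) (f j) ≡ adj (Cstar m) i j) where

    c : ℕ → Fin (n G)
    c i = f (cyc i)

    c-mod : ∀ i → c (i % m) ≡ c i
    c-mod i = cong f (cyc-cong (m%n%n≡m%n i m))

    c-periodic : ∀ i → c (i + m) ≡ c i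
    c-periodic i = cong f (cyc-cong ([m+n]%n≡m%n i m))

    c-far : ∀ i d → 2 ≤ d → d ≤ 4 → adj G (c i) (c (i + d)) ≡ false
    c-far i d 2≤d d≤4 = trans (f-adj _ _) (cyc-nonadj i 2≤d (≤-trans (s≤s (s≤s d≤4)) 6≤m))

    c-near : LocallyChordless G c
    c-near i 0 refl = subst (λ k → adj G (c i) (c k) ≡ false) (sym (+-identityʳ i)) (adj-irrefl G (c i))
    c-near i 1 refl = subst (λ k → adj G (c i) (c k) ≡ true) (+-comm 1 i)
                        (trans (f-adj _ _) (cyc-adj-suc (≤-trans (s≤s (s≤s z≤n)) 6≤m) i))
    c-near i 2 refl = c-far i 2 ≤-refl (s≤s (s≤s z≤n))
    c-near i 3 refl = c-far i 3 (s≤s (s≤s z≤n)) (s≤s (s≤s (s≤s z≤n)))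
    c-near i 4 refl = c-far i 4 (s≤s (s≤s z≤n)) ≤-refl

    SeesCycle : Fin (n G) → Set
    SeesCycle u = ∃ λ (t : Fin m) → adj G u (c (toℕ t)) ≡ true

    seesCycle? : Decidable SeesCycle
    seesCycle? u = Fin.any? λ (t : Fin m) → adj G u (c (toℕ t)) Bool.≟ true

    c-all : ∀ {u β} → (∀ (t : Fin m) → adj G u (c (toℕ t)) ≡ β) → ∀ k → adj G u (c k) ≡ β
    c-all {u} {β} all k = subst (λ v → adj G u v ≡ β) (c-mod k)
      (trans (cong (λ i → adj G u (c i)) (sym (toℕ-fromℕ< (m%n<n k m)))) (all (k mod m)))

    blind : ∀ {u} → ¬ SeesCycle u → ∀ (t : Fin m) → adj G u (c (toℕ t)) ≡ false
    blind ¬sees t = ¬-not λ e → ¬sees (t , e)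

    isolated-blind : ¬ SeesCycle (f (fromℕ m))
    isolated-blind (t , e) = contradiction (trans (sym e) (trans (f-adj _ _) (cyc-isolated _))) λ ()

    cycle-sees : SeesCycle (c 0)
    cycle-sees = 1 mod m , trans (cong (λ i → adj G (c 0) (c i)) (toℕ-fromℕ< (m%n<n 1 m)))
                             (trans (cong (adj G (c 0)) (c-mod 1)) (c-near 0 1 refl))

    -- Searching from t₀ + m puts the fall at an index ≥ 3, so its window can start at a ∸ 3.
    late-fall : ∀ {x} (t₀ t₁ : Fin m) → adj G x (c (toℕ t₀)) ≡ true → adj G x (c (toℕ t₁)) ≡ false →
      ∃[ a ] 3 ≤ a × adj G x (c a) ≡ true × adj G x (c (suc a)) ≡ false
    late-fall {x} t₀ t₁ x~t₀ x≁t₁ = map₂ (map₁ (≤-trans 3≤start)) (falling-edge (λ k → adj G x (c k)) start≤end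
      (trans (cong (adj G x) (c-periodic (toℕ t₀))) x~t₀)
      (trans (cong (adj G x) (trans (c-periodic _) (c-periodic _))) x≁t₁))
      where
      3≤start : 3 ≤ toℕ t₀ + m
      3≤start = ≤-trans (≤-trans (s≤s (s≤s (s≤s z≤n))) 6≤m) (m≤n+m m (toℕ t₀))
      start≤end : toℕ t₀ + m ≤ toℕ t₁ + m + m
      start≤end = ≤-trans (+-monoˡ-≤ m (<⇒≤ (Fin.toℕ<n t₀))) (+-monoˡ-≤ m (m≤n+m m (toℕ t₁)))

    hooked-at-fall : ∀ {x y} → adj G x y ≡ true → (∀ k → adj G y (c k) ≡ false) →
      ∀ {a} → 3 ≤ a → adj G x (c a) ≡ true → adj G x (c (suc a)) ≡ false → ⊥
    hooked-at-fall {x} {y} x~y y≁c {a} 3≤a x~a x≁a+1 =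
      Hook.falling w w-near x y x~y (λ k → y≁c (a ∸ 3 + k))
        (subst (λ k → adj G x (c k) ≡ true) (sym a∸3+3≡a) x~a)
        (subst (λ k → adj G x (c k) ≡ false) (trans (cong suc (sym a∸3+3≡a)) (sym (+-suc (a ∸ 3) 3))) x≁a+1)
      where
      w : ℕ → Fin (n G)
      w k = c (a ∸ 3 + k)
      w-near : LocallyChordless G w
      w-near i d {β} e = subst (λ k → adj G (w i) (c k) ≡ β) (+-assoc (a ∸ 3) i d) (c-near (a ∸ 3 + i) d e)
      a∸3+3≡a : a ∸ 3 + 3 ≡ a
      a∸3+3≡a = m∸n+n≡m 3≤a

    cycle-absurd : ⊥
    cycle-absurd with crossing-edge SeesCycle seesCycle? (connected (f (fromℕ m)) (c 0)) isolated-blind cycle-sees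
    ... | x , y , x~y , (t₀ , x~t₀) , y-blind with Fin.all? (λ (t : Fin m) → adj G x (c (toℕ t)) Bool.≟ true)
    ...   | yes x~all = Hook.saturated c c-near x y x~y y≁c (x~c 0) (x~c 1) (x~c 3) (x~c 4)
      where
      y≁c : ∀ k → adj G y (c k) ≡ false
      y≁c = c-all (blind y-blind)
      x~c : ∀ k → adj G x (c k) ≡ true
      x~c = c-all x~all
    ...   | no ¬x~all with Fin.¬∀⟶∃¬ m _ (λ (t : Fin m) → adj G x (c (toℕ t)) Bool.≟ true) ¬x~all
    ...     | t₁ , x≁t₁ with late-fall t₀ t₁ x~t₀ (¬-not x≁t₁)
    ...       | a , 3≤a , x~a , x≁a+1 = hooked-at-fall x~y (c-all (blind y-blind)) 3≤a x~a x≁a+1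

long-Cstar-free : ∀ {G} → Connected G → ¬ InducedSub (Cstar 3) G → ¬ InducedSub Bowtie G →
  ¬ InducedSub F1 G → ¬ InducedSub F2 G → ∀ {m} → 6 ≤ m → ¬ InducedSub (Cstar m) G
long-Cstar-free connected no-C₃* no-bowtie no-F₁ no-F₂ {suc m} 6≤m (f , _ , f-adj) =
  cycle-absurd no-C₃* no-bowtie no-F₁ no-F₂ connected 6≤m f f-adj

corollary5p3 : (G : Graph) → Reduced G → (ℓ : ℕ) → 1 ≤ ℓ → ¬ InducedSub (Cstar (suc (2 * ℓ))) G
corollary5p3 G _ 0 ()
corollary5p3 G (_ , _ , no-C₃* , _ , _) 1 _ = no-C₃*
corollary5p3 G (_ , _ , _ , no-C₅* , _) 2 _ = no-C₅*
corollary5p3 G (connected , _ , no-C₃* , _ , no-bowtie , _ , _ , _ , no-F₁ , no-F₂ , _) ℓ@(suc (suc (suc _))) _ =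
  long-Cstar-free connected no-C₃* no-bowtie no-F₁ no-F₂ (m≤n⇒m≤1+n (*-monoʳ-≤ 2 {3} {ℓ} (s≤s (s≤s (s≤s z≤n)))))
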